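{- Let $G$ be a graph with $n$ vertices and let $G'$ be its complement. Let $H$ be the graph obtained from $G'$ by adding a set $X$ of $n+1$ new pairwise non-adjacent vertices and making each vertex of $X$ adjacent to every vertex of $G'$. Then $G$ is 3-colourable if and only if $\mathrm{tcl}(H)\le 3$.
   Context: All graphs are finite, simple and undirected. For a graph $G$ and $X\subseteq V(G)$, let $\mathrm{vcc}(X)$ be the minimum number of cliques of $G$ whose union is $X$. A tree decomposition of $G$ is a pair $(T,\{X_t\}_{t\in V(T)})$ with $T$ a tree and bags $X_t\subseteq V(G)$ such that every vertex lies in some bag, both endpoints of every edge lie in a common bag, and for every vertex $v$ the nodes $t$ with $v\in X_t$ induce a connected subtree of $T$. An augmented tree decomposition is a tree decomposition together with, for each node $t$, a collection $C_t$ of cliques of $G$ whose union is $X_t$; its width is $\max_t |C_t|$. The tree-clique width $\mathrm{tcl}(G)$ is the minimum width of an augmented tree decomposition of $G$, i.e. the minimum over tree decompositions of $\max_t \mathrm{vcc}(X_t)$. -}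

module Defs where

open import Data.Nat using (ℕ; suc; _≤_)
open import Data.Fin using (Fin) renaming (_≟_ to _≟ᶠ_)
open import Data.Sum using (_⊎_; inj₁; inj₂)
open import Data.Product using (Σ; _×_; _,_)
open import Data.Bool using (Bool; true)
open import Data.List using (List; []; _∷_; drop; length)
open import Data.List.Relation.Unary.Unique.Propositional using (Unique)
open import Data.List.Relation.Unary.All using (All)
open import Relation.Nullary using (¬_; Dec; yes; no)
open import Relation.Nullary.Decidable using (_×-dec_; ¬?)
open import Relation.Binary.PropositionalEquality using (_≡_; _≢_; refl)
open import Data.Empty using (⊥)
open import Data.Unit using (⊤; tt)

-- A simple undirected graph on vertex type V (finite in all uses below:
-- Fin n or Fin n ⊎ Fin (suc n)).  Adjacency is decidable, as it is for
-- every finite graph classically.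
record Graph (V : Set) : Set₁ where
  field
    Adj        : V → V → Set
    Adj-dec    : ∀ u v → Dec (Adj u v)
    Adj-sym    : ∀ {u v} → Adj u v → Adj v u
    Adj-irrefl : ∀ v → ¬ Adj v v
open Graph public

data Walk {V : Set} (A : V → V → Set) : V → V → Set where
  []  : ∀ {v} → Walk A v v
  _∷_ : ∀ {u v w} → A u v → Walk A v w → Walk A u w

walkVerts : ∀ {V : Set} {A : V → V → Set} {u v : V} → Walk A u v → List V
walkVerts {u = u} []      = u ∷ []
walkVerts {u = u} (_ ∷ w) = u ∷ walkVerts w

walkLength : ∀ {V : Set} {A : V → V → Set} {u v : V} → Walk A u v → ℕ
walkLength []      = 0
walkLength (_ ∷ w) = suc (walkLength w)

-- A cycle: a closed walk of length ≥ 3 whose vertices (listed once each,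
-- i.e. dropping the repeated start) are pairwise distinct.
Cycle : ∀ {V : Set} → Graph V → Set
Cycle {V} G = Σ V λ u → Σ (Walk (Adj G) u u) λ w →
  (3 ≤ walkLength w) × Unique (drop 1 (walkVerts w))

Connected : ∀ {V : Set} → Graph V → Set
Connected {V} G = (u v : V) → Walk (Adj G) u v

IsTree : ∀ {m : ℕ} → Graph (Fin m) → Set
IsTree {m} T = (1 ≤ m) × Connected T × ¬ Cycle T

_∈ˢ_ : ∀ {V : Set} → V → (V → Bool) → Set
v ∈ˢ X = X v ≡ true

record TreeDecomposition {V : Set} (G : Graph V) : Set₁ where
  field
    m       : ℕ
    T       : Graph (Fin m)
    T-tree  : IsTree T
    bag     : Fin m → V → Bool
    covers-vertices : ∀ v → Σ (Fin m) λ t → v ∈ˢ bag t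
    covers-edges    : ∀ u v → Adj G u v → Σ (Fin m) λ t → (u ∈ˢ bag t) × (v ∈ˢ bag t)
    subtree-connected : ∀ v s t → v ∈ˢ bag s → v ∈ˢ bag t →
      Σ (Walk (Adj T) s t) λ w → All (λ r → v ∈ˢ bag r) (walkVerts w)
open TreeDecomposition public

IsClique : ∀ {V : Set} → Graph V → (V → Bool) → Set
IsClique {V} G K = (u v : V) → u ∈ˢ K → v ∈ˢ K → u ≢ v → Adj G u v

VccAtMost : ∀ {V : Set} → Graph V → (V → Bool) → ℕ → Set
VccAtMost {V} G X k = Σ ℕ λ j → (j ≤ k) × Σ (Fin j → V → Bool) λ K →
  ((i : Fin j) → IsClique G (K i)) ×
  ((v : V) → (v ∈ˢ X → Σ (Fin j) λ i → v ∈ˢ K i) × ((Σ (Fin j) λ i → v ∈ˢ K i) → v ∈ˢ X))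

TclAtMost : ∀ {V : Set} → Graph V → ℕ → Set₁
TclAtMost G k = Σ (TreeDecomposition G) λ D → ∀ t → VccAtMost G (bag D t) k

ThreeColourable : ∀ {n : ℕ} → Graph (Fin n) → Set
ThreeColourable {n} G = Σ (Fin n → Fin 3) λ c → ∀ u v → Adj G u v → c u ≢ c v

complement : ∀ {n : ℕ} → Graph (Fin n) → Graph (Fin n)
complement G = record
  { Adj = λ u v → (u ≢ v) × ¬ Adj G u v
  ; Adj-dec = λ u v → ¬? (u ≟ᶠ v) ×-dec ¬? (Adj-dec G u v)
  ; Adj-sym = λ { (ne , na) → (λ e → ne (sym' e)) , (λ a → na (Adj-sym G a)) }
  ; Adj-irrefl = λ { v (ne , _) → ne refl }
  }
  where
  sym' : ∀ {A : Set} {x y : A} → x ≡ y → y ≡ x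
  sym' refl = refl

-- H: complement of G plus n+1 new pairwise non-adjacent vertices (inj₂),
-- each adjacent to every vertex of the complement (inj₁).
HAdj : ∀ {n : ℕ} → Graph (Fin n) → Fin n ⊎ Fin (suc n) → Fin n ⊎ Fin (suc n) → Set
HAdj G (inj₁ u) (inj₁ v) = Adj (complement G) u v
HAdj G (inj₁ u) (inj₂ x) = ⊤
HAdj G (inj₂ x) (inj₁ v) = ⊤
HAdj G (inj₂ x) (inj₂ y) = ⊥

Hgraph : ∀ {n : ℕ} → Graph (Fin n) → Graph (Fin n ⊎ Fin (suc n))
Hgraph G = record { Adj = HAdj G ; Adj-dec = dec ; Adj-sym = sy ; Adj-irrefl = irr }
  where
  dec : ∀ a b → Dec (HAdj G a b)
  dec (inj₁ u) (inj₁ v) = Adj-dec (complement G) u v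
  dec (inj₁ u) (inj₂ x) = yes tt
  dec (inj₂ x) (inj₁ v) = yes tt
  dec (inj₂ x) (inj₂ y) = no (λ ())
  sy : ∀ {a b} → HAdj G a b → HAdj G b a
  sy {inj₁ u} {inj₁ v} e = Adj-sym (complement G) e
  sy {inj₁ u} {inj₂ x} e = tt
  sy {inj₂ x} {inj₁ v} e = tt
  irr : ∀ a → ¬ HAdj G a a
  irr (inj₁ u) = Adj-irrefl (complement G) u
  irr (inj₂ x) ()

-- A proper 3-colouring of G splits V(G) into three cliques of the complement, and every new
-- vertex is adjacent to all of them; so the star whose node t has bag V(G) ∪ {x_t} is a tree
-- decomposition of H with every bag covered by three cliques.
--
-- Conversely, the new vertices are pairwise non-adjacent, so a bag covered by three cliques
-- holds at most three of them.  If the subtrees of two old vertices a, b were disjoint, the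
-- last tree edge leaving the subtree of a on the way to that of b would have its inner end in
-- the subtree of every new vertex (each is adjacent to both a and b), putting all n + 1 ≥ 4
-- new vertices in one bag.  So the subtrees of the old vertices pairwise intersect, and by the
-- Helly property of subtrees of a tree one bag contains all of V(G); its three cliques in H
-- are independent sets of G, i.e. colour classes.  This needs n ≥ 3; smaller graphs are
-- trivially 3-colourable.
module Submission where

open import Defs
open import Data.Nat using (ℕ; zero; suc; _+_; _≤_; z≤n; s≤s)
open import Data.Fin using (Fin; zero; suc; _<_; inject≤; _↑ˡ_; _≟_)
open import Data.Fin.Properties using (any?; pigeonhole; inject≤-injective; ↑ˡ-injective; <⇒≢)
open import Data.Sum using (_⊎_; inj₁; inj₂; [_,_]′)
open import Data.Sum.Properties using (inj₂-injective)
open import Data.Product using (Σ; ∃₂; _×_; _,_; proj₁; proj₂)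
open import Data.Bool using (Bool; true; false; _∧_) renaming (_≟_ to _≟ᵇ_)
open import Data.List using (drop)
open import Data.List.Membership.Propositional using (_∈_)
open import Data.List.Relation.Binary.Subset.Propositional using (_⊆_)
open import Data.List.Relation.Unary.Any using (here; there)
open import Data.List.Relation.Unary.All as All using (All; []; _∷_)
open import Data.List.Relation.Unary.All.Properties using (anti-mono; ¬Any⇒All¬)
open import Data.List.Relation.Unary.AllPairs using ([]; _∷_)
open import Data.List.Relation.Unary.Unique.Propositional using (Unique)
open import Data.Empty using (⊥; ⊥-elim)
open import Data.Unit using (⊤; tt)
open import Function using (_∘_)
open import Function.Definitions using (Injective)
open import Relation.Nullary using (¬_; Dec; yes; no; does; contradiction)
open import Relation.Nullary.Decidable using (_×-dec_; dec-true)
open import Relation.Binary.Definitions using (DecidableEquality)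
open import Relation.Binary.PropositionalEquality using (_≡_; _≢_; refl; sym; trans; cong; subst)

module _ {V : Set} where

  _∈ˢ?_ : (v : V) (X : V → Bool) → Dec (v ∈ˢ X)
  v ∈ˢ? X = X v ≟ᵇ true

  _∩_ : (V → Bool) → (V → Bool) → V → Bool
  (A ∩ B) v = A v ∧ B v

  ∈-∩⁺ : ∀ A B {v} → v ∈ˢ A → v ∈ˢ B → v ∈ˢ (A ∩ B)
  ∈-∩⁺ A B v∈A v∈B rewrite v∈A | v∈B = refl

  ∈-∩⁻ : ∀ A B {v} → v ∈ˢ (A ∩ B) → v ∈ˢ A × v ∈ˢ B
  ∈-∩⁻ A B {v} with A v | B v
  ... | true  | true  = λ _ → refl , refl
  ... | true  | false = λ ()
  ... | false | _     = λ ()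

module _ {V : Set} {R : V → V → Set} where

  _++ʷ_ : ∀ {s t u} → Walk R s t → Walk R t u → Walk R s u
  []      ++ʷ W = W
  (e ∷ P) ++ʷ W = e ∷ (P ++ʷ W)

  start∈ : ∀ {s t} (W : Walk R s t) → s ∈ walkVerts W
  start∈ []      = here refl
  start∈ (_ ∷ _) = here refl

  ∈-++ʷ⁻ : ∀ {s t u v} (P : Walk R s t) (W : Walk R t u) →
    v ∈ walkVerts (P ++ʷ W) → v ∈ walkVerts P ⊎ v ∈ walkVerts W
  ∈-++ʷ⁻ []      W v∈W        = inj₂ v∈W
  ∈-++ʷ⁻ (e ∷ P) W (here v≡s) = inj₁ (here v≡s)
  ∈-++ʷ⁻ (e ∷ P) W (there v∈) = [ inj₁ ∘ there , inj₂ ]′ (∈-++ʷ⁻ P W v∈)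

  All-++ʷ : ∀ {Q : V → Set} {s t u} (P : Walk R s t) (W : Walk R t u) →
    All Q (walkVerts P) → All Q (walkVerts W) → All Q (walkVerts (P ++ʷ W))
  All-++ʷ P W QP QW = All.tabulate ([ All.lookup QP , All.lookup QW ]′ ∘ ∈-++ʷ⁻ P W)

  IsPath : ∀ {s t} → Walk R s t → Set
  IsPath W = Unique (walkVerts W)

  Avoids : V → ∀ {s t} → Walk R s t → Set
  Avoids u W = All (u ≢_) (walkVerts W)

  avoids-inside : ∀ {X u s t} {W : Walk R s t} → ¬ u ∈ˢ X → All (_∈ˢ X) (walkVerts W) → Avoids u W
  avoids-inside {X} u∉X = All.map λ r∈X u≡r → u∉X (subst (_∈ˢ X) (sym u≡r) r∈X)

  avoids-outside : ∀ {X u s t} {W : Walk R s t} → u ∈ˢ X → All (λ r → ¬ r ∈ˢ X) (walkVerts W) → Avoids u W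
  avoids-outside {X} u∈X = All.map λ r∉X u≡r → r∉X (subst (_∈ˢ X) u≡r u∈X)

module _ {V : Set} (G : Graph V) where

  reverse : ∀ {s t} → Walk (Adj G) s t → Walk (Adj G) t s
  reverse []      = []
  reverse (e ∷ W) = reverse W ++ʷ (Adj-sym G e ∷ [])

  reverse-⊆ : ∀ {s t} (W : Walk (Adj G) s t) → walkVerts (reverse W) ⊆ walkVerts W
  reverse-⊆ []      v∈ = v∈
  reverse-⊆ (e ∷ W) v∈ with ∈-++ʷ⁻ (reverse W) (Adj-sym G e ∷ []) v∈
  ... | inj₁ v∈W                 = there (reverse-⊆ W v∈W)
  ... | inj₂ (here refl)         = there (start∈ W)
  ... | inj₂ (there (here refl)) = here refl

module _ {V : Set} {R : V → V → Set} (_≟ᵛ_ : DecidableEquality V) where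
  open import Data.List.Membership.DecPropositional _≟ᵛ_ using (_∈?_)

  suffix-from : ∀ {s t v} (W : Walk R s t) → v ∈ walkVerts W →
    Σ (Walk R v t) λ W′ → walkVerts W′ ⊆ walkVerts W × (IsPath W → IsPath W′)
  suffix-from []      (here refl) = [] , (λ v∈ → v∈) , (λ path → path)
  suffix-from (e ∷ W) (here refl) = e ∷ W , (λ v∈ → v∈) , (λ path → path)
  suffix-from (e ∷ W) (there v∈W) with suffix-from W v∈W
  ... | W′ , W′⊆W , path = W′ , there ∘ W′⊆W , λ { (_ ∷ pathW) → path pathW }

  loop-erase : ∀ {s t} (W : Walk R s t) →
    Σ (Walk R s t) λ P → IsPath P × walkVerts P ⊆ walkVerts W
  loop-erase [] = [] , [] ∷ [] , λ v∈ → v∈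
  loop-erase {s} (e ∷ W) with loop-erase W
  ... | P , path , P⊆W with s ∈? walkVerts P
  ...   | yes s∈P = let (P′ , P′⊆P , path′) = suffix-from P s∈P in P′ , path′ path , there ∘ P⊆W ∘ P′⊆P
  ...   | no s∉P  = e ∷ P , ¬Any⇒All¬ _ s∉P ∷ path , λ { (here v≡s) → here v≡s ; (there v∈P) → there (P⊆W v∈P) }

-- Subtrees of a tree

module Tree {m : ℕ} (T : Graph (Fin m)) (tree : IsTree T) where

  private
    R : Fin m → Fin m → Set
    R = Adj T

  IsSubtree : (Fin m → Bool) → Set
  IsSubtree S = ∀ s t → s ∈ˢ S → t ∈ˢ S → Σ (Walk R s t) λ W → All (_∈ˢ S) (walkVerts W)

  Meets : (Fin m → Bool) → (Fin m → Bool) → Set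
  Meets A B = Σ (Fin m) λ t → t ∈ˢ A × t ∈ˢ B

  -- Otherwise s, p, the path from p to q and q form a cycle.
  neighbours-joined-avoiding⇒≡ : ∀ {s p q} → R s p → R s q → (W : Walk R p q) → Avoids s W → p ≡ q
  neighbours-joined-avoiding⇒≡ e f W s∉W with loop-erase _≟_ W
  ... | []    , _    , _   = refl
  ... | g ∷ P , path , P⊆W = contradiction cycle (proj₂ (proj₂ tree))
    where
    cycle : Cycle T
    cycle = _ , Adj-sym T f ∷ e ∷ g ∷ P , s≤s (s≤s (s≤s z≤n)) , anti-mono P⊆W s∉W ∷ path

  subtree-path : ∀ {S s t} → IsSubtree S → s ∈ˢ S → t ∈ˢ S →
    Σ (Walk R s t) λ P → IsPath P × All (_∈ˢ S) (walkVerts P)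
  subtree-path S-sub s∈S t∈S with S-sub _ _ s∈S t∈S
  ... | W , W⊆S with loop-erase _≟_ W
  ...   | P , path , P⊆W = P , path , anti-mono P⊆W W⊆S

  exit-edge-separates : ∀ {S u w c} → IsSubtree S → u ∈ˢ S → ¬ w ∈ˢ S → R u w → c ∈ˢ S →
    (W : Walk R c w) → ¬ Avoids u W
  exit-edge-separates S-sub u∈S w∉S e c∈S W u∉W with subtree-path S-sub u∈S c∈S
  ... | []    , _            , _          = All.lookup u∉W (start∈ W) refl
  ... | g ∷ P , (u∉P ∷ _) , (_ ∷ P⊆S)
        with neighbours-joined-avoiding⇒≡ g e (P ++ʷ W) (All-++ʷ P W u∉P u∉W)
  ...   | refl = w∉S (All.lookup P⊆S (start∈ P))

  path-within-subtree : ∀ {S s t} → IsSubtree S → (P : Walk R s t) → IsPath P →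
    s ∈ˢ S → t ∈ˢ S → All (_∈ˢ S) (walkVerts P)
  path-within-subtree S-sub [] _ s∈S _ = s∈S ∷ []
  path-within-subtree {S} S-sub (_∷_ {v = p} e P) (s∉P ∷ path) s∈S t∈S with p ∈ˢ? S
  ... | yes p∈S = s∈S ∷ path-within-subtree S-sub P path p∈S t∈S
  ... | no p∉S  = contradiction (anti-mono (reverse-⊆ T P) s∉P)
                    (exit-edge-separates S-sub s∈S p∉S e t∈S (reverse T P))

  ∩-subtree : ∀ {A B} → IsSubtree A → IsSubtree B → IsSubtree (A ∩ B)
  ∩-subtree {A} {B} A-sub B-sub s t s∈ t∈
    with ∈-∩⁻ A B s∈ | ∈-∩⁻ A B t∈
  ... | s∈A , s∈B | t∈A , t∈B with subtree-path A-sub s∈A t∈A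
  ...   | P , path , P⊆A = P , All.zipWith (λ (v∈A , v∈B) → ∈-∩⁺ A B v∈A v∈B)
                                 (P⊆A , path-within-subtree B-sub P path s∈B t∈B)

  record ExitEdge (S : Fin m → Bool) (t : Fin m) : Set where
    field
      inner outer  : Fin m
      edge         : R inner outer
      inner∈       : inner ∈ˢ S
      outer∉       : ¬ outer ∈ˢ S
      rest         : Walk R outer t
      rest-outside : All (λ r → ¬ r ∈ˢ S) (walkVerts rest)

  exit-or-outside : ∀ S {s t} → ¬ t ∈ˢ S → (W : Walk R s t) →
    ExitEdge S t ⊎ All (λ r → ¬ r ∈ˢ S) (walkVerts W)
  exit-or-outside S t∉S [] = inj₂ (t∉S ∷ [])
  exit-or-outside S {s} t∉S (e ∷ W) with exit-or-outside S t∉S W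
  ... | inj₁ exit    = inj₁ exit
  ... | inj₂ outside with s ∈ˢ? S
  ...   | yes s∈S = inj₁ (record
          { inner = s ; outer = _ ; edge = e ; inner∈ = s∈S ; outer∉ = All.lookup outside (start∈ W)
          ; rest = W ; rest-outside = outside })
  ...   | no s∉S = inj₂ (s∉S ∷ outside)

  last-exit : ∀ S {s t} → s ∈ˢ S → ¬ t ∈ˢ S → Walk R s t → ExitEdge S t
  last-exit S s∈S t∉S W with exit-or-outside S t∉S W
  ... | inj₁ exit    = exit
  ... | inj₂ outside = contradiction s∈S (All.lookup outside (start∈ W))

  -- The inner end of the last edge leaving A on a walk to B lies in every subtree meeting both.
  gate : ∀ {A B a b} → IsSubtree A → IsSubtree B → a ∈ˢ A → b ∈ˢ B → (∀ t → t ∈ˢ A → ¬ t ∈ˢ B) →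
    Σ (Fin m) λ u → u ∈ˢ A × (∀ S → IsSubtree S → Meets S A → Meets S B → u ∈ˢ S)
  gate {A} {B} {a} {b} A-sub B-sub a∈A b∈B disjoint = inner , inner∈ , through
    where
    open ExitEdge (last-exit A a∈A (λ b∈A → disjoint b b∈A b∈B) (proj₁ (proj₂ tree) a b))

    through : ∀ S → IsSubtree S → Meets S A → Meets S B → inner ∈ˢ S
    through S S-sub (c , c∈S , c∈A) (d , d∈S , d∈B) with inner ∈ˢ? S | S-sub c d c∈S d∈S | B-sub d b d∈B b∈B
    ... | yes u∈S | _ | _ = u∈S
    ... | no u∉S  | W₁ , W₁⊆S | W₂ , W₂⊆B = ⊥-elim (exit-edge-separates A-sub inner∈ outer∉ edge c∈A
          (W₁ ++ʷ (W₂ ++ʷ reverse T rest))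
          (All-++ʷ W₁ _ (avoids-inside u∉S W₁⊆S)
            (All-++ʷ W₂ _ (avoids-inside (disjoint inner inner∈) W₂⊆B)
              (anti-mono (reverse-⊆ T rest) (avoids-outside inner∈ rest-outside)))))

  helly₃ : ∀ {A B C} → IsSubtree A → IsSubtree B → IsSubtree C →
    Meets A B → Meets A C → Meets B C → Σ (Fin m) λ t → t ∈ˢ A × t ∈ˢ B × t ∈ˢ C
  helly₃ {A} {B} {C} A-sub B-sub C-sub (s , s∈A , s∈B) (t , t∈A , t∈C) (r , r∈B , r∈C)
    with any? (λ v → (v ∈ˢ? (A ∩ B)) ×-dec (v ∈ˢ? C)) | ∈-∩⁺ A B s∈A s∈B
  ... | yes (v , v∈AB , v∈C) | _ = v , proj₁ (∈-∩⁻ A B v∈AB) , proj₂ (∈-∩⁻ A B v∈AB) , v∈C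
  ... | no disjoint | s∈AB
    with gate C-sub (∩-subtree A-sub B-sub) t∈C s∈AB (λ v v∈C v∈AB → disjoint (v , v∈AB , v∈C))
  ...   | u , u∈C , through =
    u , through A A-sub (t , t∈A , t∈C) (s , s∈A , s∈AB) , through B B-sub (r , r∈B , r∈C) (s , s∈B , s∈AB) , u∈C

  -- Induction on the family, replacing S i by S i ∩ S zero; helly₃ keeps it pairwise meeting.
  helly : ∀ k (S : Fin (suc k) → Fin m → Bool) → (∀ i → IsSubtree (S i)) → (∀ i j → Meets (S i) (S j)) →
    Σ (Fin m) λ t → ∀ i → t ∈ˢ S i
  helly zero S _ meet = proj₁ (meet zero zero) , λ { zero → proj₁ (proj₂ (meet zero zero)) ; (suc ()) }
  helly (suc k) S sub meet with helly k (λ i → S (suc i) ∩ S zero) (λ i → ∩-subtree (sub (suc i)) (sub zero)) meet′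
    where
    meet′ : ∀ i j → Meets (S (suc i) ∩ S zero) (S (suc j) ∩ S zero)
    meet′ i j with helly₃ (sub (suc i)) (sub (suc j)) (sub zero) (meet _ _) (meet _ _) (meet _ _)
    ... | t , t∈i , t∈j , t∈0 = t , ∈-∩⁺ (S (suc i)) (S zero) t∈i t∈0 , ∈-∩⁺ (S (suc j)) (S zero) t∈j t∈0
  ... | t , t∈ = t , λ { zero → proj₂ (∈-∩⁻ (S (suc zero)) (S zero) (t∈ zero)) ; (suc i) → proj₁ (∈-∩⁻ (S (suc i)) (S zero) (t∈ i)) }

independent-set-exceeds-cover : ∀ {V} (G : Graph V) {X k} → VccAtMost G X k →
  (f : Fin (suc k) → V) → Injective _≡_ _≡_ f → (∀ i j → ¬ Adj G (f i) (f j)) → (∀ i → f i ∈ˢ X) → ⊥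
independent-set-exceeds-cover G {k = k} (j , j≤k , K , clique , cover) f f-inj independent f∈X =
  clash (pigeonhole (s≤s j≤k) class)
  where
  class : Fin (suc k) → Fin j
  class i = proj₁ (proj₁ (cover (f i)) (f∈X i))

  in-class : ∀ i → f i ∈ˢ K (class i)
  in-class i = proj₂ (proj₁ (cover (f i)) (f∈X i))

  clash : ∃₂ (λ i i′ → i < i′ × class i ≡ class i′) → ⊥
  clash (i , i′ , i<i′ , same) =
    independent i i′ (clique (class i) (f i) (f i′) (in-class i)
      (subst (λ c → f i′ ∈ˢ K c) (sym same) (in-class i′)) (<⇒≢ i<i′ ∘ f-inj))

-- Cliques of H restricted to the old vertices are independent sets of G.
cover-of-old-vertices-colours : ∀ {n} (G : Graph (Fin n)) {X} → VccAtMost (Hgraph G) X 3 →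
  (∀ a → inj₁ a ∈ˢ X) → ThreeColourable G
cover-of-old-vertices-colours {n} G (j , j≤3 , K , clique , cover) old∈X = colour , proper
  where
  class : Fin n → Fin j
  class a = proj₁ (proj₁ (cover (inj₁ a)) (old∈X a))

  in-class : ∀ a → inj₁ a ∈ˢ K (class a)
  in-class a = proj₂ (proj₁ (cover (inj₁ a)) (old∈X a))

  colour : Fin n → Fin 3
  colour a = inject≤ (class a) j≤3

  proper : ∀ a b → Adj G a b → colour a ≢ colour b
  proper a b ab same = proj₂ (clique (class a) (inj₁ a) (inj₁ b) (in-class a) b∈ a≢b) ab
    where
    b∈ : inj₁ b ∈ˢ K (class a)
    b∈ = subst (λ c → inj₁ b ∈ˢ K c) (sym (inject≤-injective j≤3 j≤3 _ _ same)) (in-class b)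

    a≢b : inj₁ a ≢ inj₁ b
    a≢b refl = Adj-irrefl G a ab

few-vertices-colourable : ∀ {n} (G : Graph (Fin n)) → n ≤ 3 → ThreeColourable G
few-vertices-colourable G n≤3 = (λ a → inject≤ a n≤3) , λ a b ab same →
  Adj-irrefl G b (subst (λ c → Adj G c b) (inject≤-injective n≤3 n≤3 a b same) ab)

StarAdj : ∀ {k} → Fin k → Fin k → Set
StarAdj zero    zero    = ⊥
StarAdj zero    (suc _) = ⊤
StarAdj (suc _) zero    = ⊤
StarAdj (suc _) (suc _) = ⊥

star : ∀ k → Graph (Fin k)
star k = record { Adj = StarAdj ; Adj-dec = dec ; Adj-sym = symm ; Adj-irrefl = irrefl }
  where
  dec : ∀ a b → Dec (StarAdj a b)
  dec zero    zero    = no λ ()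
  dec zero    (suc _) = yes tt
  dec (suc _) zero    = yes tt
  dec (suc _) (suc _) = no λ ()

  symm : ∀ {a b} → StarAdj a b → StarAdj b a
  symm {zero}  {suc _} _ = tt
  symm {suc _} {zero}  _ = tt

  irrefl : ∀ a → ¬ StarAdj a a
  irrefl zero    ()
  irrefl (suc _) ()

star-centre : ∀ {k} {a b c : Fin (suc k)} → StarAdj a b → StarAdj b c → a ≢ c → b ≡ zero
star-centre {a = _}     {zero}  {_}     _  _  _   = refl
star-centre {a = zero}  {suc _} {zero}  _  _  a≢c = contradiction refl a≢c
star-centre {a = zero}  {suc _} {suc _} _  () _
star-centre {a = suc _} {suc _} {_}     () _  _

star-leaves-non-adjacent : ∀ {k} {a b : Fin (suc k)} → StarAdj a b → a ≢ zero → b ≢ zero → ⊥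
star-leaves-non-adjacent {a = zero}  {_}     _  a≢0 _   = a≢0 refl
star-leaves-non-adjacent {a = suc _} {zero}  _  _   b≢0 = b≢0 refl
star-leaves-non-adjacent {a = suc _} {suc _} () _   _

-- Of three consecutive distinct vertices of a cycle the middle one is the centre, so the next
-- edge joins two leaves.
star-acyclic : ∀ {k} → ¬ Cycle (star (suc k))
star-acyclic (_ , W , long , distinct) = go W long distinct
  where
  go : ∀ {k} {u : Fin (suc k)} (W : Walk StarAdj u u) → 3 ≤ walkLength W → Unique (drop 1 (walkVerts W)) → ⊥
  go (_ ∷ [])     (s≤s ()) _
  go (_ ∷ _ ∷ []) (s≤s (s≤s ())) _
  go (e₁ ∷ e₂ ∷ e₃ ∷ []) _ ((v₁≢v₂ ∷ v₁≢v₃ ∷ []) ∷ (v₂≢v₃ ∷ []) ∷ _)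
    with star-centre e₂ e₃ v₁≢v₃
  ... | refl = star-leaves-non-adjacent e₁ (v₂≢v₃ ∘ sym) v₁≢v₂
  go (e₁ ∷ e₂ ∷ e₃ ∷ e₄ ∷ W) _ ((v₁≢v₂ ∷ v₁≢v₃ ∷ _) ∷ (v₂≢v₃ ∷ v₂≢W) ∷ _)
    with star-centre e₂ e₃ v₁≢v₃
  ... | refl = star-leaves-non-adjacent e₄ (v₂≢v₃ ∘ sym) (All.lookup v₂≢W (start∈ W) ∘ sym)

star-tree : ∀ k → IsTree (star (suc k))
star-tree k = s≤s z≤n , (λ s t → to-centre s ++ʷ from-centre t) , star-acyclic
  where
  to-centre : (s : Fin (suc k)) → Walk StarAdj s zero
  to-centre zero    = []
  to-centre (suc _) = tt ∷ []

  from-centre : (t : Fin (suc k)) → Walk StarAdj zero t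
  from-centre zero    = []
  from-centre (suc _) = tt ∷ []

does-≟⇒≡ : ∀ {k} (x t : Fin k) → does (x ≟ t) ≡ true → x ≡ t
does-≟⇒≡ x t h with x ≟ t
... | yes x≡t = x≡t

module _ {n : ℕ} (G : Graph (Fin n)) where

  star-bag : Fin (suc n) → Fin n ⊎ Fin (suc n) → Bool
  star-bag t (inj₁ _) = true
  star-bag t (inj₂ x) = does (x ≟ t)

  star-decomposition : TreeDecomposition (Hgraph G)
  star-decomposition = record
    { m = suc n
    ; T = star (suc n)
    ; T-tree = star-tree n
    ; bag = star-bag
    ; covers-vertices = λ { (inj₁ _) → zero , refl ; (inj₂ x) → x , dec-true (x ≟ x) refl }
    ; covers-edges = λ
        { (inj₁ _) (inj₁ _) _ → zero , refl , refl
        ; (inj₁ _) (inj₂ x) _ → x , refl , dec-true (x ≟ x) refl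
        ; (inj₂ x) (inj₁ _) _ → x , dec-true (x ≟ x) refl , refl }
    ; subtree-connected = connected
    }
    where
    connected : ∀ v s t → v ∈ˢ star-bag s → v ∈ˢ star-bag t →
      Σ (Walk StarAdj s t) λ W → All (λ r → v ∈ˢ star-bag r) (walkVerts W)
    connected (inj₁ _) s t _ _ = proj₁ (proj₂ (star-tree n)) s t , All.tabulate (λ _ → refl)
    connected (inj₂ x) s t x∈s x∈t with does-≟⇒≡ x s x∈s | does-≟⇒≡ x t x∈t
    ... | refl | refl = [] , x∈s ∷ []

  star-bags-covered : ThreeColourable G → ∀ t → VccAtMost (Hgraph G) (star-bag t) 3
  star-bags-covered (colour , proper) t = 3 , s≤s (s≤s (s≤s z≤n)) , K , clique , cover
    where
    K : Fin 3 → Fin n ⊎ Fin (suc n) → Bool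
    K i (inj₁ a) = does (colour a ≟ i)
    K i (inj₂ x) = does (x ≟ t)

    clique : ∀ i → IsClique (Hgraph G) (K i)
    clique i (inj₁ a) (inj₁ b) a∈ b∈ a≢b =
      (λ a≡b → a≢b (cong inj₁ a≡b)) ,
      λ ab → proper a b ab (trans (does-≟⇒≡ (colour a) i a∈) (sym (does-≟⇒≡ (colour b) i b∈)))
    clique i (inj₁ _) (inj₂ _) _ _ _ = tt
    clique i (inj₂ _) (inj₁ _) _ _ _ = tt
    clique i (inj₂ x) (inj₂ y) x∈ y∈ x≢y with does-≟⇒≡ x t x∈ | does-≟⇒≡ y t y∈
    ... | refl | refl = x≢y refl

    cover : ∀ v → (v ∈ˢ star-bag t → Σ (Fin 3) λ i → v ∈ˢ K i) × ((Σ (Fin 3) λ i → v ∈ˢ K i) → v ∈ˢ star-bag t)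
    cover (inj₁ a) = (λ _ → colour a , dec-true (colour a ≟ colour a) refl) , λ _ → refl
    cover (inj₂ x) = (λ x∈ → zero , x∈) , proj₂

-- A bag containing every old vertex

module OldVerticesShareABag {k : ℕ} (G : Graph (Fin (3 + k))) (D : TreeDecomposition (Hgraph G))
  (narrow : ∀ t → VccAtMost (Hgraph G) (bag D t) 3) where

  open Tree (T D) (T-tree D)

  nodes : Fin (3 + k) ⊎ Fin (4 + k) → Fin (m D) → Bool
  nodes v t = bag D t v

  no-bag-holds-all-new : ∀ t → ¬ (∀ x → inj₂ x ∈ˢ bag D t)
  no-bag-holds-all-new t all-new = independent-set-exceeds-cover (Hgraph G) (narrow t)
    (λ i → inj₂ (i ↑ˡ k)) (↑ˡ-injective k _ _ ∘ inj₂-injective) (λ _ _ ()) (λ i → all-new (i ↑ˡ k))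

  old-vertices-meet : ∀ a b → Meets (nodes (inj₁ a)) (nodes (inj₁ b))
  old-vertices-meet a b with any? (λ t → (t ∈ˢ? nodes (inj₁ a)) ×-dec (t ∈ˢ? nodes (inj₁ b)))
  ... | yes meet    = meet
  ... | no disjoint
    with gate (subtree-connected D (inj₁ a)) (subtree-connected D (inj₁ b))
           (proj₂ (covers-vertices D (inj₁ a))) (proj₂ (covers-vertices D (inj₁ b)))
           (λ t t∈a t∈b → disjoint (t , t∈a , t∈b))
  ...   | u , _ , through = ⊥-elim (no-bag-holds-all-new u λ x →
          through (nodes (inj₂ x)) (subtree-connected D (inj₂ x))
            (covers-edges D (inj₂ x) (inj₁ a) tt) (covers-edges D (inj₂ x) (inj₁ b) tt))

  bag-of-old-vertices : Σ (Fin (m D)) λ t → ∀ a → inj₁ a ∈ˢ bag D t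
  bag-of-old-vertices = helly (2 + k) (λ a → nodes (inj₁ a)) (λ a → subtree-connected D (inj₁ a)) old-vertices-meet

colourable-if-tcl≤3 : ∀ {n} (G : Graph (Fin n)) → TclAtMost (Hgraph G) 3 → ThreeColourable G
colourable-if-tcl≤3 {0}               G _ = few-vertices-colourable G z≤n
colourable-if-tcl≤3 {1}               G _ = few-vertices-colourable G (s≤s z≤n)
colourable-if-tcl≤3 {2}               G _ = few-vertices-colourable G (s≤s (s≤s z≤n))
colourable-if-tcl≤3 {suc (suc (suc k))} G (D , narrow)
  with OldVerticesShareABag.bag-of-old-vertices G D narrow
... | t , old∈t = cover-of-old-vertices-colours G (narrow t) old∈t

lemma5 : (n : ℕ) (G : Graph (Fin n)) →
    (ThreeColourable G → TclAtMost (Hgraph G) 3) × (TclAtMost (Hgraph G) 3 → ThreeColourable G)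
lemma5 n G = (λ colouring → star-decomposition G , star-bags-covered G colouring) , colourable-if-tcl≤3 G
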